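{- Let $L$ be a non-trivial extension of $\mathsf{BD}$. Then $L$ has the proof by cases property if and only if $L\in\{\mathsf{BD},\mathsf{KO},\mathsf{LP},\mathsf{K},\mathsf{CL}\}$, and likewise $L$ has the weak proof by cases property if and only if $L\in\{\mathsf{BD},\mathsf{KO},\mathsf{LP},\mathsf{K},\mathsf{CL}\}$.
   Context: Formulas are built from a countably infinite set of variables using $\wedge,\vee$, ${\sim}$, $\top,\bot$. A logic is a set of rules $\Gamma\vdash\varphi$ closed under reflexivity, monotonicity, cut and substitution; an extension of $L$ is a logic containing $L$; the trivial logic contains all rules. For a matrix, a rule is valid if every valuation sending the premises into the designated set sends the conclusion there. Let $\mathbf{DM}_4$ be the De Morgan algebra on $\{\bot,n,b,\top\}$ with $\bot<n,b<\top$ ($n,b$ incomparable), ${\sim}$ swapping $\top,\bot$ and fixing $n,b$. $\mathsf{BD}$, $\mathsf{K}$, $\mathsf{LP}$, $\mathsf{CL}$ are the sets of rules valid in $\langle\mathbf{DM}_4,\{b,\top\}\rangle$, $\langle\{\bot,n,\top\},\{\top\}\rangle$, $\langle\{\bot,b,\top\},\{b,\top\}\rangle$, $\langle\{\bot,\top\},\{\top\}\rangle$ respectively (subalgebras of $\mathbf{DM}_4$), and $\mathsf{KO}=\mathsf{LP}\cap\mathsf{K}$. $L$ has the proof by cases property if for all sets $\Gamma$ and formulas $\varphi,\psi,\chi$: $\Gamma,\varphi\vee\psi\vdash_L\chi$ iff ($\Gamma,\varphi\vdash_L\chi$ and $\Gamma,\psi\vdash_L\chi$); the weak proof by cases property is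 this condition restricted to $\Gamma=\emptyset$. -}

module Defs where

open import Data.Nat using (ℕ)
open import Data.Product using (_×_; Σ; ∃; _,_)
open import Data.Sum using (_⊎_)
open import Data.Empty using (⊥)
open import Relation.Nullary using (¬_)
open import Relation.Binary.PropositionalEquality using (_≡_)

infixr 6 _∧_
infixr 5 _∨_

data Fm : Set where
  var  : ℕ → Fm
  _∧_  : Fm → Fm → Fm
  _∨_  : Fm → Fm → Fm
  ∼_   : Fm → Fm
  top  : Fm
  bot  : Fm

FmSet : Set₁
FmSet = Fm → Set

∅ : FmSet
∅ _ = ⊥

_,,_ : FmSet → Fm → FmSet
(Γ ,, φ) χ = Γ χ ⊎ χ ≡ φ

_∪_ : FmSet → FmSet → FmSet
(Γ ∪ Δ) χ = Γ χ ⊎ Δ χ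

_⊆_ : FmSet → FmSet → Set
Γ ⊆ Δ = ∀ χ → Γ χ → Δ χ

Subst : Set
Subst = ℕ → Fm

_[_] : Fm → Subst → Fm
var i [ σ ] = σ i
(φ ∧ ψ) [ σ ] = (φ [ σ ]) ∧ (ψ [ σ ])
(φ ∨ ψ) [ σ ] = (φ [ σ ]) ∨ (ψ [ σ ])
(∼ φ) [ σ ] = ∼ (φ [ σ ])
top [ σ ] = top
bot [ σ ] = bot

img : Subst → FmSet → FmSet
img σ Γ χ = Σ Fm (λ ψ → Γ ψ × χ ≡ (ψ [ σ ]))

Rules : Set₁
Rules = FmSet → Fm → Set

record IsLogic (L : Rules) : Set₁ where
  field
    reflexivity  : ∀ Γ φ → Γ φ → L Γ φ
    monotonicity : ∀ Γ Δ φ → Γ ⊆ Δ → L Γ φ → L Δ φ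
    cut          : ∀ Γ Δ φ → (∀ ψ → Δ ψ → L Γ ψ) → L (Γ ∪ Δ) φ → L Γ φ
    substitution : ∀ Γ φ (σ : Subst) → L Γ φ → L (img σ Γ) (φ [ σ ])

_⊑_ : Rules → Rules → Set₁
L' ⊑ L = ∀ Γ φ → L' Γ φ → L Γ φ

_≐_ : Rules → Rules → Set₁
L ≐ L' = (L ⊑ L') × (L' ⊑ L)

Trivial : Rules
Trivial _ _ = Data.Unit.⊤
  where import Data.Unit

NonTrivial : Rules → Set₁
NonTrivial L = ¬ (Trivial ⊑ L)

data DM4 : Set where
  ⊥' n b ⊤' : DM4

_⊓_ : DM4 → DM4 → DM4
⊥' ⊓ y = ⊥'
⊤' ⊓ y = y
n ⊓ ⊥' = ⊥'
n ⊓ n = n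
n ⊓ b = ⊥'
n ⊓ ⊤' = n
b ⊓ ⊥' = ⊥'
b ⊓ n = ⊥'
b ⊓ b = b
b ⊓ ⊤' = b

_⊔_ : DM4 → DM4 → DM4
⊥' ⊔ y = y
⊤' ⊔ y = ⊤'
n ⊔ ⊥' = n
n ⊔ n = n
n ⊔ b = ⊤'
n ⊔ ⊤' = ⊤'
b ⊔ ⊥' = b
b ⊔ n = ⊤'
b ⊔ b = b
b ⊔ ⊤' = ⊤'

neg : DM4 → DM4
neg ⊥' = ⊤'
neg n = n
neg b = b
neg ⊤' = ⊥'

eval : (ℕ → DM4) → Fm → DM4
eval v (var i) = v i
eval v (φ ∧ ψ) = eval v φ ⊓ eval v ψ
eval v (φ ∨ ψ) = eval v φ ⊔ eval v ψ
eval v (∼ φ) = neg (eval v φ)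
eval v top = ⊤'
eval v bot = ⊥'

-- Validity in the matrix ⟨A, D⟩ where A is the subalgebra of DM4 with
-- universe U (U is closed under the operations in all cases used below)
-- and D ⊆ U is the designated set.
Valid : (U : DM4 → Set) (D : DM4 → Set) → Rules
Valid U D Γ φ =
  (v : ℕ → DM4) → (∀ i → U (v i)) →
  (∀ ψ → Γ ψ → D (eval v ψ)) → D (eval v φ)

All4 : DM4 → Set
All4 _ = Data.Unit.⊤
  where import Data.Unit

UK : DM4 → Set
UK x = x ≡ ⊥' ⊎ x ≡ n ⊎ x ≡ ⊤'

ULP : DM4 → Set
ULP x = x ≡ ⊥' ⊎ x ≡ b ⊎ x ≡ ⊤'

UCL : DM4 → Set
UCL x = x ≡ ⊥' ⊎ x ≡ ⊤'

Dbt : DM4 → Set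
Dbt x = x ≡ b ⊎ x ≡ ⊤'

Dt : DM4 → Set
Dt x = x ≡ ⊤'

BD K LP CL KO : Rules
BD = Valid All4 Dbt
K  = Valid UK Dt
LP = Valid ULP Dbt
CL = Valid UCL Dt
KO Γ φ = LP Γ φ × K Γ φ

PBC : Rules → Set₁
PBC L = ∀ (Γ : FmSet) (φ ψ χ : Fm) →
  (L (Γ ,, (φ ∨ ψ)) χ → L (Γ ,, φ) χ × L (Γ ,, ψ) χ) ×
  (L (Γ ,, φ) χ × L (Γ ,, ψ) χ → L (Γ ,, (φ ∨ ψ)) χ)

WeakPBC : Rules → Set
WeakPBC L = ∀ (φ ψ χ : Fm) →
  (L (∅ ,, (φ ∨ ψ)) χ → L (∅ ,, φ) χ × L (∅ ,, ψ) χ) ×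
  (L (∅ ,, φ) χ × L (∅ ,, ψ) χ → L (∅ ,, (φ ∨ ψ)) χ)

InFive : Rules → Set₁
InFive L = L ≐ BD ⊎ L ≐ KO ⊎ L ≐ LP ⊎ L ≐ K ⊎ L ≐ CL

-- Each of BD, LP, K and CL is the logic of a matrix whose designated set is a prime
-- filter, hence has proof by cases; so does KO = LP ∩ K, and the property transfers
-- along equality of logics.
--
-- Conversely, let L ⊇ BD be non-trivial with the weak proof by cases property. L is
-- determined by which of the rules  p ∧ ∼p ⊢ q ∨ ∼q,  p ∧ ∼p ⊢ q  and  ⊢ q ∨ ∼q  it
-- contains. A rule missing from L gives an upper bound: a DM4-countermodel of a rule
-- of L is pulled back, along a substitution into p and q, to a derivation of the
-- missing rule; non-triviality likewise gives L ⊆ CL. A rule present in L gives a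
-- lower bound: ⊢ q ∨ ∼q lifts BD-consequence to LP-consequence, and explosion together
-- with weak proof by cases lifts it to K-consequence. The latter rests on compactness:
-- if Γ ⊨_K χ then Γ ⊨_BD χ ∨ ⋁_{i<N} (p_i ∧ ∼p_i) for some N, by König's lemma.

module Submission where

open import Defs
open import Axiom.ExcludedMiddle using (ExcludedMiddle)
open import Axiom.DoubleNegationElimination using (em⇒dne)
open import Data.Nat using (ℕ; zero; suc; _+_; _<_; _≤_; _≟_)
open import Data.Nat.Properties using (≤-refl; ≤-trans; <-irrefl; m≤m+n; m≤n+m; m<1+n⇒m<n∨m≡n)
open import Data.Product using (_×_; Σ; Σ-syntax; ∃-syntax; _,_; proj₁; proj₂)
open import Data.Sum using (_⊎_; inj₁; inj₂)
open import Data.Empty using (⊥-elim)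
open import Function using (id; _∘_)
open import Function.Bundles using (_⇔_; mk⇔)
open import Level using (0ℓ)
open import Relation.Nullary using (¬_; Dec; yes; no; ¬?)
open import Relation.Nullary.Decidable
  using (True; toWitness; map′; _×-dec_; _⊎-dec_; _→-dec_; decidable-stable)
open import Relation.Binary.PropositionalEquality using (_≡_; refl; sym; trans; cong; cong₂; subst)

_≟ᴰ_ : (x y : DM4) → Dec (x ≡ y)
⊥' ≟ᴰ ⊥' = yes refl
⊥' ≟ᴰ n  = no λ ()
⊥' ≟ᴰ b  = no λ ()
⊥' ≟ᴰ ⊤' = no λ ()
n  ≟ᴰ ⊥' = no λ ()
n  ≟ᴰ n  = yes refl
n  ≟ᴰ b  = no λ ()
n  ≟ᴰ ⊤' = no λ ()
b  ≟ᴰ ⊥' = no λ ()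
b  ≟ᴰ n  = no λ ()
b  ≟ᴰ b  = yes refl
b  ≟ᴰ ⊤' = no λ ()
⊤' ≟ᴰ ⊥' = no λ ()
⊤' ≟ᴰ n  = no λ ()
⊤' ≟ᴰ b  = no λ ()
⊤' ≟ᴰ ⊤' = yes refl

Dbt? : ∀ x → Dec (Dbt x)
Dbt? x = x ≟ᴰ b ⊎-dec x ≟ᴰ ⊤'

Dt? : ∀ x → Dec (Dt x)
Dt? x = x ≟ᴰ ⊤'

UK? : ∀ x → Dec (UK x)
UK? x = x ≟ᴰ ⊥' ⊎-dec x ≟ᴰ n ⊎-dec x ≟ᴰ ⊤'

ULP? : ∀ x → Dec (ULP x)
ULP? x = x ≟ᴰ ⊥' ⊎-dec x ≟ᴰ b ⊎-dec x ≟ᴰ ⊤'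

UCL? : ∀ x → Dec (UCL x)
UCL? x = x ≟ᴰ ⊥' ⊎-dec x ≟ᴰ ⊤'

all? : {P : DM4 → Set} → (∀ x → Dec (P x)) → Dec (∀ x → P x)
all? P? = map′ (λ (p⊥ , pn , pb , p⊤) → λ { ⊥' → p⊥ ; n → pn ; b → pb ; ⊤' → p⊤ })
               (λ p → p ⊥' , p n , p b , p ⊤')
               (P? ⊥' ×-dec P? n ×-dec P? b ×-dec P? ⊤')

decide₁ : {P : DM4 → Set} (P? : ∀ x → Dec (P x)) → {True (all? P?)} → ∀ x → P x
decide₁ P? {holds} = toWitness holds

decide₂ : {P : DM4 → DM4 → Set} (P? : ∀ x y → Dec (P x y)) →
  {True (all? λ x → all? (P? x))} → ∀ x y → P x y
decide₂ P? {holds} = toWitness holds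

decide₄ : {P : DM4 → DM4 → DM4 → DM4 → Set} (P? : ∀ w x y z → Dec (P w x y z)) →
  {True (all? λ w → all? λ x → all? λ y → all? (P? w x y))} → ∀ w x y z → P w x y z
decide₄ P? {holds} = toWitness holds

Dbt-⊔ˡ : ∀ x y → Dbt x → Dbt (x ⊔ y)
Dbt-⊔ˡ = decide₂ λ x y → Dbt? x →-dec Dbt? (x ⊔ y)

Dbt-⊔ʳ : ∀ x y → Dbt y → Dbt (x ⊔ y)
Dbt-⊔ʳ = decide₂ λ x y → Dbt? y →-dec Dbt? (x ⊔ y)

Dbt-⊔⁻ : ∀ x y → Dbt (x ⊔ y) → Dbt x ⊎ Dbt y
Dbt-⊔⁻ = decide₂ λ x y → Dbt? (x ⊔ y) →-dec (Dbt? x ⊎-dec Dbt? y)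

¬Dbt-⊥' : ¬ Dbt ⊥'
¬Dbt-⊥' (inj₁ ())
¬Dbt-⊥' (inj₂ ())

-- The information order of DM4 (n below ⊥' and ⊤', both below b), read off the
-- truth and falsity components of a value.
_≤ᵢ_ : DM4 → DM4 → Set
x ≤ᵢ y = (Dbt x → Dbt y) × (Dbt (neg x) → Dbt (neg y))

_≤ᵢ?_ : ∀ x y → Dec (x ≤ᵢ y)
x ≤ᵢ? y = (Dbt? x →-dec Dbt? y) ×-dec (Dbt? (neg x) →-dec Dbt? (neg y))

≤ᵢ-refl : ∀ {x} → x ≤ᵢ x
≤ᵢ-refl = id , id

n≤ᵢ : ∀ x → n ≤ᵢ x
n≤ᵢ = decide₁ λ x → n ≤ᵢ? x

≤ᵢb : ∀ x → x ≤ᵢ b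
≤ᵢb = decide₁ λ x → x ≤ᵢ? b

⊓-mono-≤ᵢ : ∀ x x' y y' → x ≤ᵢ x' → y ≤ᵢ y' → (x ⊓ y) ≤ᵢ (x' ⊓ y')
⊓-mono-≤ᵢ = decide₄ λ x x' y y' → x ≤ᵢ? x' →-dec y ≤ᵢ? y' →-dec (x ⊓ y) ≤ᵢ? (x' ⊓ y')

⊔-mono-≤ᵢ : ∀ x x' y y' → x ≤ᵢ x' → y ≤ᵢ y' → (x ⊔ y) ≤ᵢ (x' ⊔ y')
⊔-mono-≤ᵢ = decide₄ λ x x' y y' → x ≤ᵢ? x' →-dec y ≤ᵢ? y' →-dec (x ⊔ y) ≤ᵢ? (x' ⊔ y')

neg-mono-≤ᵢ : ∀ x x' → x ≤ᵢ x' → neg x ≤ᵢ neg x'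
neg-mono-≤ᵢ = decide₂ λ x x' → x ≤ᵢ? x' →-dec neg x ≤ᵢ? neg x'

glut⇒b≤ᵢ : ∀ x → Dbt (x ⊓ neg x) → b ≤ᵢ x
glut⇒b≤ᵢ = decide₁ λ x → Dbt? (x ⊓ neg x) →-dec b ≤ᵢ? x

¬glut⇒UK : ∀ x → ¬ Dbt (x ⊓ neg x) → UK x
¬glut⇒UK = decide₁ λ x → ¬? (Dbt? (x ⊓ neg x)) →-dec UK? x

¬exm⇒≤ᵢn : ∀ x → ¬ Dbt (x ⊔ neg x) → x ≤ᵢ n
¬exm⇒≤ᵢn = decide₁ λ x → ¬? (Dbt? (x ⊔ neg x)) →-dec x ≤ᵢ? n

exm⇒ULP : ∀ x → Dbt (x ⊔ neg x) → ULP x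
exm⇒ULP = decide₁ λ x → Dbt? (x ⊔ neg x) →-dec ULP? x

exm⇒UCL : ∀ x → UK x → Dbt (x ⊔ neg x) → UCL x
exm⇒UCL = decide₁ λ x → UK? x →-dec Dbt? (x ⊔ neg x) →-dec UCL? x

Dbt⇒Dt-UK : ∀ x → UK x → Dbt x → Dt x
Dbt⇒Dt-UK = decide₁ λ x → UK? x →-dec Dbt? x →-dec Dt? x

Dbt⇒Dt-UCL : ∀ x → UCL x → Dbt x → Dt x
Dbt⇒Dt-UCL = decide₁ λ x → UCL? x →-dec Dbt? x →-dec Dt? x

b∉UK : ¬ UK b
b∉UK (inj₁ ())
b∉UK (inj₂ (inj₁ ()))
b∉UK (inj₂ (inj₂ ()))

n∉ULP : ¬ ULP n
n∉ULP (inj₁ ())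
n∉ULP (inj₂ (inj₁ ()))
n∉ULP (inj₂ (inj₂ ()))

b∉UCL : ¬ UCL b
b∉UCL (inj₁ ())
b∉UCL (inj₂ ())

n∉UCL : ¬ UCL n
n∉UCL (inj₁ ())
n∉UCL (inj₂ ())

record IsSubalgebra (U : DM4 → Set) : Set where
  field
    ⊓-closed   : ∀ x y → U x → U y → U (x ⊓ y)
    ⊔-closed   : ∀ x y → U x → U y → U (x ⊔ y)
    neg-closed : ∀ x → U x → U (neg x)
    ⊤'-closed  : U ⊤'
    ⊥'-closed  : U ⊥'

UK-subalgebra : IsSubalgebra UK
UK-subalgebra = record
  { ⊓-closed   = decide₂ λ x y → UK? x →-dec UK? y →-dec UK? (x ⊓ y)
  ; ⊔-closed   = decide₂ λ x y → UK? x →-dec UK? y →-dec UK? (x ⊔ y)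
  ; neg-closed = decide₁ λ x → UK? x →-dec UK? (neg x)
  ; ⊤'-closed  = inj₂ (inj₂ refl)
  ; ⊥'-closed  = inj₁ refl
  }

UCL-subalgebra : IsSubalgebra UCL
UCL-subalgebra = record
  { ⊓-closed   = decide₂ λ x y → UCL? x →-dec UCL? y →-dec UCL? (x ⊓ y)
  ; ⊔-closed   = decide₂ λ x y → UCL? x →-dec UCL? y →-dec UCL? (x ⊔ y)
  ; neg-closed = decide₁ λ x → UCL? x →-dec UCL? (neg x)
  ; ⊤'-closed  = inj₂ refl
  ; ⊥'-closed  = inj₁ refl
  }

Below : ℕ → (ℕ → Set) → Set
Below N P = ∀ i → i < N → P i

Below-≤ : ∀ {M N P} → M ≤ N → Below N P → Below M P
Below-≤ M≤N below i i<M = below i (≤-trans i<M M≤N)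

Agree : ℕ → (ℕ → DM4) → (ℕ → DM4) → Set
Agree k u u' = Below k λ i → u i ≡ u' i

varBound : Fm → ℕ
varBound (var i) = suc i
varBound (φ ∧ ψ) = varBound φ + varBound ψ
varBound (φ ∨ ψ) = varBound φ + varBound ψ
varBound (∼ φ)   = varBound φ
varBound top     = 0
varBound bot     = 0

eval-agree : ∀ {u u'} φ → Agree (varBound φ) u u' → eval u φ ≡ eval u' φ
eval-agree (var i) agree = agree i ≤-refl
eval-agree (φ ∧ ψ) agree =
  cong₂ _⊓_ (eval-agree φ (Below-≤ (m≤m+n _ _) agree)) (eval-agree ψ (Below-≤ (m≤n+m _ _) agree))
eval-agree (φ ∨ ψ) agree =
  cong₂ _⊔_ (eval-agree φ (Below-≤ (m≤m+n _ _) agree)) (eval-agree ψ (Below-≤ (m≤n+m _ _) agree))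
eval-agree (∼ φ) agree = cong neg (eval-agree φ agree)
eval-agree top agree = refl
eval-agree bot agree = refl

eval-subst : ∀ u σ φ → eval u (φ [ σ ]) ≡ eval (λ i → eval u (σ i)) φ
eval-subst u σ (var i) = refl
eval-subst u σ (φ ∧ ψ) = cong₂ _⊓_ (eval-subst u σ φ) (eval-subst u σ ψ)
eval-subst u σ (φ ∨ ψ) = cong₂ _⊔_ (eval-subst u σ φ) (eval-subst u σ ψ)
eval-subst u σ (∼ φ)   = cong neg (eval-subst u σ φ)
eval-subst u σ top     = refl
eval-subst u σ bot     = refl

eval-mono : ∀ {u u'} → (∀ i → u i ≤ᵢ u' i) → ∀ φ → eval u φ ≤ᵢ eval u' φ
eval-mono u≤u' (var i) = u≤u' i
eval-mono u≤u' (φ ∧ ψ) = ⊓-mono-≤ᵢ _ _ _ _ (eval-mono u≤u' φ) (eval-mono u≤u' ψ)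
eval-mono u≤u' (φ ∨ ψ) = ⊔-mono-≤ᵢ _ _ _ _ (eval-mono u≤u' φ) (eval-mono u≤u' ψ)
eval-mono u≤u' (∼ φ)   = neg-mono-≤ᵢ _ _ (eval-mono u≤u' φ)
eval-mono u≤u' top     = ≤ᵢ-refl
eval-mono u≤u' bot     = ≤ᵢ-refl

eval-closed : ∀ {U} → IsSubalgebra U → ∀ v → (∀ i → U (v i)) → ∀ φ → U (eval v φ)
eval-closed sub v vU (var i) = vU i
eval-closed sub v vU (φ ∧ ψ) = IsSubalgebra.⊓-closed sub _ _ (eval-closed sub v vU φ) (eval-closed sub v vU ψ)
eval-closed sub v vU (φ ∨ ψ) = IsSubalgebra.⊔-closed sub _ _ (eval-closed sub v vU φ) (eval-closed sub v vU ψ)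
eval-closed sub v vU (∼ φ)   = IsSubalgebra.neg-closed sub _ (eval-closed sub v vU φ)
eval-closed sub v vU top     = IsSubalgebra.⊤'-closed sub
eval-closed sub v vU bot     = IsSubalgebra.⊥'-closed sub

Designates : (ℕ → DM4) → FmSet → Set
Designates v Γ = ∀ ψ → Γ ψ → Dbt (eval v ψ)

Refutes : (ℕ → DM4) → FmSet → Fm → Set
Refutes v Γ χ = Designates v Γ × ¬ Dbt (eval v χ)

Designates-,, : ∀ {v Γ θ} → Designates v Γ → Dbt (eval v θ) → Designates v (Γ ,, θ)
Designates-,, vΓ vθ ψ (inj₁ ψ∈Γ) = vΓ ψ ψ∈Γ
Designates-,, vΓ vθ ψ (inj₂ refl) = vθ

⊑-trans : ∀ {L₁ L₂ L₃} → L₁ ⊑ L₂ → L₂ ⊑ L₃ → L₁ ⊑ L₃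
⊑-trans L₁⊑L₂ L₂⊑L₃ Γ φ = L₂⊑L₃ Γ φ ∘ L₁⊑L₂ Γ φ

Valid-⊑ : ∀ {U D D'} → IsSubalgebra U →
  (∀ x → U x → D' x → D x) → (∀ x → U x → D x → D' x) → Valid U D ⊑ Valid U D'
Valid-⊑ sub D'⇒D D⇒D' Γ χ valid v vU vΓ =
  D⇒D' _ (eval-closed sub v vU χ)
    (valid v vU λ ψ ψ∈Γ → D'⇒D _ (eval-closed sub v vU ψ) (vΓ ψ ψ∈Γ))

K≐ : K ≐ Valid UK Dbt
K≐ = Valid-⊑ UK-subalgebra Dbt⇒Dt-UK (λ _ _ → inj₂) , Valid-⊑ UK-subalgebra (λ _ _ → inj₂) Dbt⇒Dt-UK

CL≐ : CL ≐ Valid UCL Dbt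
CL≐ = Valid-⊑ UCL-subalgebra Dbt⇒Dt-UCL (λ _ _ → inj₂) , Valid-⊑ UCL-subalgebra (λ _ _ → inj₂) Dbt⇒Dt-UCL

range : (ℕ → Fm) → FmSet
range f ψ = ∃[ y ] ψ ≡ f y

glut exm : ℕ → Fm
glut i = var i ∧ ∼ var i
exm i = var i ∨ ∼ var i

LP-via-BD : ∀ {Γ χ} → LP Γ χ → BD (Γ ∪ range λ y → χ ∨ exm y) χ
LP-via-BD {χ = χ} lp v _ vΓ with Dbt? (eval v χ)
... | yes vχ = vχ
... | no ¬vχ = lp v vLP (λ ψ ψ∈Γ → vΓ ψ (inj₁ ψ∈Γ))
  where
  vLP : ∀ i → ULP (v i)
  vLP i with Dbt-⊔⁻ _ _ (vΓ _ (inj₂ (i , refl)))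
  ... | inj₁ vχ = ⊥-elim (¬vχ vχ)
  ... | inj₂ vexm = exm⇒ULP (v i) vexm

CL-via-K : ∀ {Γ χ} → CL Γ χ → Valid UK Dbt (Γ ∪ range exm) χ
CL-via-K {Γ} {χ} cl v vK vΓ =
  proj₁ CL≐ Γ χ cl v (λ i → exm⇒UCL (v i) (vK i) (vΓ _ (inj₂ (i , refl)))) (λ ψ ψ∈Γ → vΓ ψ (inj₁ ψ∈Γ))

-- Proof by cases for the five logics

PBC-Valid : ∀ U → PBC (Valid U Dbt)
PBC-Valid U Γ φ ψ χ = split , join
  where
  split : Valid U Dbt (Γ ,, (φ ∨ ψ)) χ → Valid U Dbt (Γ ,, φ) χ × Valid U Dbt (Γ ,, ψ) χ
  split valid =
    (λ v vU vΓφ → valid v vU (Designates-,, (λ θ → vΓφ θ ∘ inj₁) (Dbt-⊔ˡ _ _ (vΓφ φ (inj₂ refl))))) ,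
    (λ v vU vΓψ → valid v vU (Designates-,, (λ θ → vΓψ θ ∘ inj₁) (Dbt-⊔ʳ _ _ (vΓψ ψ (inj₂ refl)))))
  join : Valid U Dbt (Γ ,, φ) χ × Valid U Dbt (Γ ,, ψ) χ → Valid U Dbt (Γ ,, (φ ∨ ψ)) χ
  join (validφ , validψ) v vU vΓφ∨ψ with Dbt-⊔⁻ _ _ (vΓφ∨ψ (φ ∨ ψ) (inj₂ refl))
  ... | inj₁ vφ = validφ v vU (Designates-,, (λ θ → vΓφ∨ψ θ ∘ inj₁) vφ)
  ... | inj₂ vψ = validψ v vU (Designates-,, (λ θ → vΓφ∨ψ θ ∘ inj₁) vψ)

PBC-∩ : ∀ {L L'} → PBC L → PBC L' → PBC (λ Γ φ → L Γ φ × L' Γ φ)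
PBC-∩ pbc pbc' Γ φ ψ χ with pbc Γ φ ψ χ | pbc' Γ φ ψ χ
... | split , join | split' , join' =
  (λ (d , d') → (proj₁ (split d) , proj₁ (split' d')) , (proj₂ (split d) , proj₂ (split' d'))) ,
  (λ ((dφ , dφ') , (dψ , dψ')) → join (dφ , dψ) , join' (dφ' , dψ'))

PBC-resp-≐ : ∀ {L L'} → L ≐ L' → PBC L' → PBC L
PBC-resp-≐ (L⊑L' , L'⊑L) pbc Γ φ ψ χ =
  (λ d → let (dφ , dψ) = proj₁ (pbc Γ φ ψ χ) (L⊑L' _ _ d) in L'⊑L _ _ dφ , L'⊑L _ _ dψ) ,
  (λ (dφ , dψ) → L'⊑L _ _ (proj₂ (pbc Γ φ ψ χ) (L⊑L' _ _ dφ , L⊑L' _ _ dψ)))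

PBC-K : PBC K
PBC-K = PBC-resp-≐ K≐ (PBC-Valid UK)

PBC-KO : PBC KO
PBC-KO = PBC-∩ {LP} {K} (PBC-Valid ULP) PBC-K

PBC-InFive : ∀ {L} → InFive L → PBC L
PBC-InFive (inj₁ L≐BD)                      = PBC-resp-≐ L≐BD (PBC-Valid All4)
PBC-InFive (inj₂ (inj₁ L≐KO))               = PBC-resp-≐ L≐KO PBC-KO
PBC-InFive (inj₂ (inj₂ (inj₁ L≐LP)))        = PBC-resp-≐ L≐LP (PBC-Valid ULP)
PBC-InFive (inj₂ (inj₂ (inj₂ (inj₁ L≐K))))  = PBC-resp-≐ L≐K PBC-K
PBC-InFive (inj₂ (inj₂ (inj₂ (inj₂ L≐CL)))) = PBC-resp-≐ L≐CL (PBC-resp-≐ CL≐ (PBC-Valid UCL))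

PBC⇒WeakPBC : ∀ {L} → PBC L → WeakPBC L
PBC⇒WeakPBC pbc = pbc ∅

module Classical (lem : ExcludedMiddle 0ℓ) where

  dne : {P : Set} → ¬ ¬ P → P
  dne = em⇒dne lem

  ¬∀⇒∃¬ : {P : ℕ → Set} → ¬ (∀ N → P N) → ∃[ N ] ¬ P N
  ¬∀⇒∃¬ ¬all = dne λ ¬ex → ¬all λ N → dne λ ¬P → ¬ex (N , ¬P)

  countermodel : ∀ {U Γ χ} → ¬ Valid U Dbt Γ χ → ∃[ v ] (∀ i → U (v i)) × Refutes v Γ χ
  countermodel ¬valid = dne λ ¬ex → ¬valid λ v vU vΓ → dne λ ¬vχ → ¬ex (v , vU , vΓ , ¬vχ)

-- Compactness of K

glutDisj : Fm → ℕ → Fm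
glutDisj χ zero    = χ
glutDisj χ (suc N) = glutDisj χ N ∨ glut N

glutDisj-refuted : ∀ {u} χ N → ¬ Dbt (eval u (glutDisj χ N)) →
  ¬ Dbt (eval u χ) × Below N (UK ∘ u)
glutDisj-refuted χ zero ¬uχ = ¬uχ , λ _ ()
glutDisj-refuted {u} χ (suc N) ¬u = proj₁ refuted , below
  where
  refuted : ¬ Dbt (eval u χ) × Below N (UK ∘ u)
  refuted = glutDisj-refuted χ N (¬u ∘ Dbt-⊔ˡ _ _)
  below : Below (suc N) (UK ∘ u)
  below i i<1+N with m<1+n⇒m<n∨m≡n i<1+N
  ... | inj₁ i<N = proj₂ refuted i i<N
  ... | inj₂ refl = ¬glut⇒UK (u i) (¬u ∘ Dbt-⊔ʳ _ _)

update : (ℕ → DM4) → ℕ → DM4 → ℕ → DM4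
update s k a i with i ≟ k
... | yes _ = a
... | no _  = s i

update-≡ : ∀ s k a → update s k a k ≡ a
update-≡ s k a with k ≟ k
... | yes _   = refl
... | no k≢k = ⊥-elim (k≢k refl)

update-< : ∀ s k a {i} → i < k → update s k a i ≡ s i
update-< s k a {i} i<k with i ≟ k
... | yes refl = ⊥-elim (<-irrefl refl i<k)
... | no _     = refl

Agree-update : ∀ {k u s} → Agree k u s → Agree (suc k) u (update s k (u k))
Agree-update {k} {u} {s} agree i i<1+k with m<1+n⇒m<n∨m≡n i<1+k
... | inj₁ i<k = trans (agree i i<k) (sym (update-< s k (u k) i<k))
... | inj₂ refl = sym (update-≡ s k (u k))

module Compactness (lem : ExcludedMiddle 0ℓ) (Γ : FmSet) (χ : Fm) where
  open Classical lem

  Approx : ℕ → (ℕ → DM4) → ℕ → Set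
  Approx k s N = Σ[ u ∈ (ℕ → DM4) ] Refutes u Γ χ × Below N (UK ∘ u) × Agree k u s

  -- The prefixes of length k of the sequences s with Good k s form the finitely branching
  -- tree to which König's lemma is applied.
  Good : ℕ → (ℕ → DM4) → Set
  Good k s = ∀ N → Approx k s N

  Approx-≤ : ∀ {k s M N} → M ≤ N → Approx k s N → Approx k s M
  Approx-≤ M≤N (u , refutes , uK , agree) = u , refutes , Below-≤ M≤N uK , agree

  narrow : ∀ {k s M N} → M ≤ N → k < N → Approx k s N →
    Σ[ a ∈ DM4 ] UK a × Approx (suc k) (update s k a) M
  narrow M≤N k<N (u , refutes , uK , agree) =
    u _ , uK _ k<N , u , refutes , Below-≤ M≤N uK , Agree-update agree

  Good-extends : ∀ {k s} → Good k s → ¬ (∀ {a} → UK a → ¬ Good (suc k) (update s k a))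
  Good-extends {k} {s} good dead =
    let (_ , ua , approx) = narrow (m≤m+n M (suc k)) (m≤n+m (suc k) M) (good (M + suc k))
    in proj₂ (fail ua) (Approx-≤ (bounded ua) approx)
    where
    fail : ∀ {a} → UK a → ∃[ M ] ¬ Approx (suc k) (update s k a) M
    fail ua = ¬∀⇒∃¬ (dead ua)
    M : ℕ
    M = proj₁ (fail (inj₁ refl)) + proj₁ (fail (inj₂ (inj₁ refl))) + proj₁ (fail (inj₂ (inj₂ refl)))
    bounded : ∀ {a} (ua : UK a) → proj₁ (fail ua) ≤ M
    bounded (inj₁ refl)         = ≤-trans (m≤m+n _ _) (m≤m+n _ _)
    bounded (inj₂ (inj₁ refl))  = ≤-trans (m≤n+m _ (proj₁ (fail (inj₁ refl)))) (m≤m+n _ _)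
    bounded (inj₂ (inj₂ refl))  = m≤n+m _ _

  extend : ∀ {k s} → Good k s → Σ[ a ∈ DM4 ] UK a × Good (suc k) (update s k a)
  extend good = dne λ ¬ext → Good-extends good λ ua g → ¬ext (_ , ua , g)

  module Limit (good₀ : Good 0 (λ _ → ⊥')) where
    chain : ∀ k → Σ (ℕ → DM4) (Good k)
    limit : ℕ → DM4
    limit k = proj₁ (extend (proj₂ (chain k)))
    chain zero    = _ , good₀
    chain (suc k) = update (proj₁ (chain k)) k (limit k) , proj₂ (proj₂ (extend (proj₂ (chain k))))

    limit-UK : ∀ k → UK (limit k)
    limit-UK k = proj₁ (proj₂ (extend (proj₂ (chain k))))

    chain-limit : ∀ k → Agree k (proj₁ (chain k)) limit
    chain-limit zero i ()
    chain-limit (suc k) i i<1+k with m<1+n⇒m<n∨m≡n i<1+k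
    ... | inj₁ i<k  = trans (update-< _ k _ i<k) (chain-limit k i i<k)
    ... | inj₂ refl = update-≡ _ k _

    approximates : ∀ φ → Σ[ u ∈ (ℕ → DM4) ] Refutes u Γ χ × eval u φ ≡ eval limit φ
    approximates φ =
      let (u , refutes , _ , agree) = proj₂ (chain (varBound φ)) 0
      in u , refutes , eval-agree φ λ i i<k → trans (agree i i<k) (chain-limit _ i i<k)

    limit-refutes : Refutes limit Γ χ
    limit-refutes =
      (λ ψ ψ∈Γ → let (u , (uΓ , _) , u≡) = approximates ψ in subst Dbt u≡ (uΓ ψ ψ∈Γ)) ,
      (λ limitχ → let (u , (_ , ¬uχ) , u≡) = approximates χ in ¬uχ (subst Dbt (sym u≡) limitχ))

  K-compact : Valid UK Dbt Γ χ → ∃[ N ] BD Γ (glutDisj χ N)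
  K-compact valid = dne λ ¬bd →
    let open Limit (good₀ ¬bd) in proj₂ limit-refutes (valid limit limit-UK (proj₁ limit-refutes))
    where
    good₀ : ¬ (∃[ N ] BD Γ (glutDisj χ N)) → Good 0 (λ _ → ⊥')
    good₀ ¬bd N =
      let (u , _ , uΓ , ¬u) = countermodel {All4} {Γ} {glutDisj χ N} λ bd → ¬bd (N , bd)
          (¬uχ , uK) = glutDisj-refuted χ N ¬u
      in u , (uΓ , ¬uχ) , uK , λ _ ()

-- Extensions of BD

⌜_⌝ : DM4 → Fm
⌜ ⊥' ⌝ = bot
⌜ n ⌝  = var 1
⌜ b ⌝  = var 0
⌜ ⊤' ⌝ = top

⌜⌝-above : ∀ u x → (x ≡ b → b ≤ᵢ u 0) → x ≤ᵢ eval u ⌜ x ⌝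
⌜⌝-above u ⊥' _ = ≤ᵢ-refl
⌜⌝-above u n  _ = n≤ᵢ _
⌜⌝-above u b  h = h refl
⌜⌝-above u ⊤' _ = ≤ᵢ-refl

⌜⌝-below : ∀ u x → (x ≡ n → u 1 ≤ᵢ n) → eval u ⌜ x ⌝ ≤ᵢ x
⌜⌝-below u ⊥' _ = ≤ᵢ-refl
⌜⌝-below u n  h = h refl
⌜⌝-below u b  _ = ≤ᵢb _
⌜⌝-below u ⊤' _ = ≤ᵢ-refl

sub₂ : Fm → Fm → Subst
sub₂ α β zero          = α
sub₂ α β (suc zero)    = β
sub₂ α β (suc (suc _)) = bot

module Extension (lem : ExcludedMiddle 0ℓ) (L : Rules) (isL : IsLogic L) (BD⊑L : BD ⊑ L) where
  open IsLogic isL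
  open Classical lem

  _⊢_ : Fm → Fm → Set
  α ⊢ β = L (∅ ,, α) β

  ⊢-refl : ∀ {α} → α ⊢ α
  ⊢-refl = reflexivity _ _ (inj₂ refl)

  cut-all : ∀ {Γ Δ χ} → (∀ ψ → Δ ψ → L Γ ψ) → L Δ χ → L Γ χ
  cut-all {Γ} {Δ} {χ} Γ⊢Δ Δ⊢χ = cut Γ Δ χ Γ⊢Δ (monotonicity Δ (Γ ∪ Δ) χ (λ _ → inj₂) Δ⊢χ)

  cut₁ : ∀ {Γ α β} → L Γ α → α ⊢ β → L Γ β
  cut₁ Γ⊢α = cut-all λ { _ (inj₂ refl) → Γ⊢α }

  cut-range : ∀ {Γ f χ} → (∀ y → L Γ (f y)) → L (Γ ∪ range f) χ → L Γ χ
  cut-range Γ⊢f = cut-all λ { ψ (inj₁ ψ∈Γ) → reflexivity _ ψ ψ∈Γ ; _ (inj₂ (y , refl)) → Γ⊢f y }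

  ⊢-instance : ∀ {α β} → α ⊢ β → ∀ σ → (α [ σ ]) ⊢ (β [ σ ])
  ⊢-instance {α} {β} α⊢β σ = monotonicity _ _ _ image⊆ (substitution _ β σ α⊢β)
    where
    image⊆ : img σ (∅ ,, α) ⊆ (∅ ,, (α [ σ ]))
    image⊆ _ (_ , inj₂ refl , refl) = inj₂ refl

  ⊢-fromBD : ∀ {α β} → (∀ u → Dbt (eval u α) → Dbt (eval u β)) → α ⊢ β
  ⊢-fromBD α⊨β = BD⊑L _ _ λ u _ uα → α⊨β u (uα _ (inj₂ refl))

  top-derivable : ∀ Γ → L Γ top
  top-derivable Γ = BD⊑L Γ top λ _ _ _ → inj₂ refl

  KleeneRule ExplosionRule ExclMiddleRule : Set
  KleeneRule     = glut 0 ⊢ exm 1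
  ExplosionRule  = glut 0 ⊢ var 1
  ExclMiddleRule = top ⊢ exm 1

  -- A countermodel v of a rule Γ ⊢ χ of L yields the rule α ⊢ β via the substitution
  -- i ↦ ⌜ v i ⌝: the hypotheses make α push every ⌜ v i ⌝ above v i and ¬ β push it
  -- below, so α ⊨_BD σ[Γ] and σ(χ) ⊨_BD β by monotonicity of evaluation.
  reduce : ∀ {U : DM4 → Set} {Γ χ α β v} →
    (U b → ∀ u → Dbt (eval u α) → b ≤ᵢ u 0) →
    (U n → ∀ u → ¬ Dbt (eval u β) → u 1 ≤ᵢ n) →
    (∀ i → U (v i)) → Refutes v Γ χ → L Γ χ → α ⊢ β
  reduce {U} {Γ} {χ} {α} {β} {v} up down vU (vΓ , ¬vχ) Γ⊢χ =
    cut₁ (cut-all premises (substitution Γ χ σ Γ⊢χ)) conclusion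
    where
    σ : Subst
    σ i = ⌜ v i ⌝
    premises : ∀ θ → img σ Γ θ → α ⊢ θ
    premises _ (ψ , ψ∈Γ , refl) = ⊢-fromBD λ u uα →
      subst Dbt (sym (eval-subst u σ ψ)) (proj₁ (eval-mono (v≤σu u uα) ψ) (vΓ ψ ψ∈Γ))
      where
      v≤σu : ∀ u → Dbt (eval u α) → ∀ i → v i ≤ᵢ eval u (σ i)
      v≤σu u uα i = ⌜⌝-above u (v i) λ vi≡b → up (subst U vi≡b (vU i)) u uα
    σu≤v : ∀ u → ¬ Dbt (eval u β) → ∀ i → eval u (σ i) ≤ᵢ v i
    σu≤v u ¬uβ i = ⌜⌝-below u (v i) λ vi≡n → down (subst U vi≡n (vU i)) u ¬uβ
    conclusion : (χ [ σ ]) ⊢ β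
    conclusion = ⊢-fromBD λ u uσχ → decidable-stable (Dbt? _) λ ¬uβ →
      ¬vχ (proj₁ (eval-mono (σu≤v u ¬uβ) χ) (subst Dbt (eval-subst u σ χ) uσχ))

  upper-bound : ∀ {U : DM4 → Set} {α β} →
    (U b → ∀ u → Dbt (eval u α) → b ≤ᵢ u 0) →
    (U n → ∀ u → ¬ Dbt (eval u β) → u 1 ≤ᵢ n) →
    ¬ α ⊢ β → L ⊑ Valid U Dbt
  upper-bound {U} up down ¬α⊢β Γ χ Γ⊢χ = dne λ ¬valid →
    let (v , vU , refutes) = countermodel {U} {Γ} {χ} ¬valid in ¬α⊢β (reduce {U} up down vU refutes Γ⊢χ)

  L⊑BD : ¬ KleeneRule → L ⊑ BD
  L⊑BD = upper-bound {All4} (λ _ u → glut⇒b≤ᵢ (u 0)) (λ _ u → ¬exm⇒≤ᵢn (u 1))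

  L⊑LP : ¬ ExplosionRule → L ⊑ LP
  L⊑LP = upper-bound {ULP} (λ _ u → glut⇒b≤ᵢ (u 0)) (λ n∈ULP → ⊥-elim (n∉ULP n∈ULP))

  L⊑K : ¬ ExclMiddleRule → L ⊑ K
  L⊑K ¬exm = ⊑-trans (upper-bound {UK} (λ b∈UK → ⊥-elim (b∉UK b∈UK)) (λ _ u → ¬exm⇒≤ᵢn (u 1)) ¬exm)
                     (proj₂ K≐)

  L⊑CL : NonTrivial L → L ⊑ CL
  L⊑CL nontrivial =
    ⊑-trans (upper-bound {UCL} (λ b∈UCL → ⊥-elim (b∉UCL b∈UCL)) (λ n∈UCL → ⊥-elim (n∉UCL n∈UCL)) ¬⊤⊢⊥)
            (proj₂ CL≐)
    where
    ¬⊤⊢⊥ : ¬ top ⊢ bot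
    ¬⊤⊢⊥ ⊤⊢⊥ = nontrivial λ Γ φ _ →
      cut₁ (cut₁ (top-derivable Γ) ⊤⊢⊥) (⊢-fromBD λ _ ⊥-designated → ⊥-elim (¬Dbt-⊥' ⊥-designated))

  glutDisj-elim : ∀ {χ θ} → WeakPBC L → (∀ i → glut i ⊢ θ) → χ ⊢ θ → ∀ N → glutDisj χ N ⊢ θ
  glutDisj-elim wpbc glut⊢θ χ⊢θ zero    = χ⊢θ
  glutDisj-elim wpbc glut⊢θ χ⊢θ (suc N) = proj₂ (wpbc _ _ _) (glutDisj-elim wpbc glut⊢θ χ⊢θ N , glut⊢θ N)

  UK-elim : ∀ {Γ χ θ} → WeakPBC L → (∀ i → glut i ⊢ θ) → χ ⊢ θ → Valid UK Dbt Γ χ → L Γ θ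
  UK-elim {Γ} {χ} wpbc glut⊢θ χ⊢θ valid =
    let (N , bd) = Compactness.K-compact lem Γ χ valid
    in cut₁ (BD⊑L _ _ bd) (glutDisj-elim wpbc glut⊢θ χ⊢θ N)

  UK⊑L : WeakPBC L → ExplosionRule → Valid UK Dbt ⊑ L
  UK⊑L wpbc explosion Γ χ = UK-elim wpbc (λ i → ⊢-instance explosion (sub₂ (var i) χ)) ⊢-refl

  ∨-introˡ : ∀ χ θ → χ ⊢ (χ ∨ θ)
  ∨-introˡ χ θ = ⊢-fromBD λ _ → Dbt-⊔ˡ _ _

  ∨-introʳ : ∀ χ θ → θ ⊢ (χ ∨ θ)
  ∨-introʳ χ θ = ⊢-fromBD λ _ → Dbt-⊔ʳ _ _

  LP-elim : ∀ {Γ χ} → LP Γ χ → (∀ y → L Γ (χ ∨ exm y)) → L Γ χ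
  LP-elim lp Γ⊢χ∨exm = cut-range Γ⊢χ∨exm (BD⊑L _ _ (LP-via-BD lp))

  exm-derivable : ExclMiddleRule → ∀ Γ y → L Γ (exm y)
  exm-derivable exclMiddle Γ y = cut₁ (top-derivable Γ) (⊢-instance exclMiddle (sub₂ top (var y)))

  LP⊑L : ExclMiddleRule → LP ⊑ L
  LP⊑L exclMiddle Γ χ lp = LP-elim lp λ y → cut₁ (exm-derivable exclMiddle Γ y) (∨-introʳ χ (exm y))

  KO⊑L : WeakPBC L → KleeneRule → KO ⊑ L
  KO⊑L wpbc kleene Γ χ (lp , k) = LP-elim lp λ y →
    UK-elim wpbc (λ i → cut₁ (⊢-instance kleene (sub₂ (var i) (var y))) (∨-introʳ χ (exm y)))
      (∨-introˡ χ (exm y)) (proj₁ K≐ Γ χ k)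

  CL⊑L : WeakPBC L → ExplosionRule → ExclMiddleRule → CL ⊑ L
  CL⊑L wpbc explosion exclMiddle Γ χ cl =
    cut-range (exm-derivable exclMiddle Γ) (UK⊑L wpbc explosion (Γ ∪ range exm) χ (CL-via-K {Γ} {χ} cl))

  classify : WeakPBC L → NonTrivial L → InFive L
  classify wpbc nontrivial with lem {KleeneRule} | lem {ExplosionRule} | lem {ExclMiddleRule}
  ... | no ¬kleene | _ | _ = inj₁ (L⊑BD ¬kleene , BD⊑L)
  ... | yes kleene | no ¬explosion | no ¬exclMiddle =
    inj₂ (inj₁ ((λ Γ χ d → L⊑LP ¬explosion Γ χ d , L⊑K ¬exclMiddle Γ χ d) , KO⊑L wpbc kleene))
  ... | yes _ | no ¬explosion | yes exclMiddle =
    inj₂ (inj₂ (inj₁ (L⊑LP ¬explosion , LP⊑L exclMiddle)))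
  ... | yes _ | yes explosion | no ¬exclMiddle =
    inj₂ (inj₂ (inj₂ (inj₁ (L⊑K ¬exclMiddle , ⊑-trans (proj₁ K≐) (UK⊑L wpbc explosion)))))
  ... | yes _ | yes explosion | yes exclMiddle =
    inj₂ (inj₂ (inj₂ (inj₂ (L⊑CL nontrivial , CL⊑L wpbc explosion exclMiddle))))

proposition6p18 : ExcludedMiddle 0ℓ →
    (L : Rules) → IsLogic L → BD ⊑ L → NonTrivial L →
    (PBC L ⇔ InFive L) × (WeakPBC L ⇔ InFive L)
proposition6p18 lem L isL BD⊑L nontrivial =
  mk⇔ (λ pbc → classify (PBC⇒WeakPBC {L} pbc) nontrivial) (PBC-InFive {L}) ,
  mk⇔ (λ wpbc → classify wpbc nontrivial) (PBC⇒WeakPBC {L} ∘ PBC-InFive {L})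
  where open Extension lem L isL BD⊑L
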